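{- Let $G$ be a graph with $n$ vertices. Then $k(G)=\theta_E(G)$ if and only if $G$ is the complete graph $K_n$ or $G$ is the edgeless graph $I_n$ on $n$ vertices.
   Context: All graphs are finite, simple and undirected. The competition graph $C(D)$ of a digraph $D$ is the graph with vertex set $V(D)$ in which distinct $x,y$ are adjacent iff there is a vertex $v$ with $(x,v),(y,v)$ both arcs of $D$. The competition number $k(G)$ of a graph $G$ is the minimum integer $k\ge 0$ such that $G$ together with $k$ new isolated vertices is the competition graph of an acyclic digraph. A clique of $G$ is a vertex subset inducing a complete graph; an edge clique cover is a family of cliques such that each edge has both endpoints in some clique of the family; $\theta_E(G)$ is the minimum size of an edge clique cover of $G$. -}

module Defs where

open import Data.Nat using (ℕ; _+_; _≤_)
open import Data.Fin using (Fin; splitAt)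
open import Data.Fin.Subset using (Subset; _∈_)
open import Data.Bool using (Bool; true; false)
open import Data.Sum using (_⊎_; inj₁; inj₂)
open import Data.Product using (Σ; ∃; _×_)
open import Relation.Nullary using (¬_)
open import Relation.Binary.PropositionalEquality using (_≡_; _≢_)
open import Relation.Binary.Construct.Closure.Transitive using (TransClosure)
open import Function.Bundles using (_⇔_)

record Graph (n : ℕ) : Set where
  field
    adj    : Fin n → Fin n → Bool
    sym    : ∀ x y → adj x y ≡ adj y x
    irrefl : ∀ x → adj x x ≡ false
open Graph public

record Digraph (m : ℕ) : Set where
  field
    arc : Fin m → Fin m → Bool
open Digraph public

Arc : ∀ {m} → Digraph m → Fin m → Fin m → Set
Arc D x y = arc D x y ≡ true

Acyclic : ∀ {m} → Digraph m → Set
Acyclic D = ∀ v → ¬ TransClosure (Arc D) v v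

IsCompetitionGraph : ∀ {m} → Digraph m → Graph m → Set
IsCompetitionGraph {m} D H =
  ∀ x y → (adj H x y ≡ true) ⇔ (x ≢ y × Σ (Fin m) λ v → Arc D x v × Arc D y v)

adjIso : ∀ {n} k → Graph n → Fin (n + k) → Fin (n + k) → Bool
adjIso {n} k G x y with splitAt n x | splitAt n y
... | inj₁ a | inj₁ b = adj G a b
... | inj₁ _ | inj₂ _ = false
... | inj₂ _ | _      = false

addIsolated : ∀ {n} → Graph n → (k : ℕ) → Graph (n + k)
addIsolated {n} G k = record { adj = adjIso k G ; sym = s ; irrefl = i }
  where
  s : ∀ x y → adjIso k G x y ≡ adjIso k G y x
  s x y with splitAt n x | splitAt n y
  ... | inj₁ a | inj₁ b = sym G a b
  ... | inj₁ _ | inj₂ _ = Relation.Binary.PropositionalEquality.refl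
  ... | inj₂ _ | inj₁ _ = Relation.Binary.PropositionalEquality.refl
  ... | inj₂ _ | inj₂ _ = Relation.Binary.PropositionalEquality.refl
  i : ∀ x → adjIso k G x x ≡ false
  i x with splitAt n x
  ... | inj₁ a = irrefl G a
  ... | inj₂ _ = Relation.Binary.PropositionalEquality.refl

CompetitionAchievable : ∀ {n} → Graph n → ℕ → Set
CompetitionAchievable {n} G k =
  Σ (Digraph (n + k)) λ D → Acyclic D × IsCompetitionGraph D (addIsolated G k)

IsCompetitionNumber : ∀ {n} → Graph n → ℕ → Set
IsCompetitionNumber G k =
  CompetitionAchievable G k × (∀ k' → CompetitionAchievable G k' → k ≤ k')

IsClique : ∀ {n} → Graph n → Subset n → Set
IsClique G C = ∀ x y → x ∈ C → y ∈ C → x ≢ y → adj G x y ≡ true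

IsEdgeCliqueCover : ∀ {n t} → Graph n → (Fin t → Subset n) → Set
IsEdgeCliqueCover {t = t} G C =
  (∀ i → IsClique G (C i)) ×
  (∀ x y → adj G x y ≡ true → Σ (Fin t) λ i → x ∈ C i × y ∈ C i)

HasEdgeCliqueCoverOfSize : ∀ {n} → Graph n → ℕ → Set
HasEdgeCliqueCoverOfSize {n} G t = Σ (Fin t → Subset n) λ C → IsEdgeCliqueCover G C

IsEdgeCliqueCoverNumber : ∀ {n} → Graph n → ℕ → Set
IsEdgeCliqueCoverNumber G t =
  HasEdgeCliqueCoverOfSize G t × (∀ t' → HasEdgeCliqueCoverOfSize G t' → t ≤ t')

IsComplete : ∀ {n} → Graph n → Set
IsComplete G = ∀ x y → x ≢ y → adj G x y ≡ true

IsEdgeless : ∀ {n} → Graph n → Set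
IsEdgeless G = ∀ x y → adj G x y ≡ false

module Submission where

-- Upper bounds come from explicit acyclic digraphs on G ∪ I_k in which only
-- the vertices of G have out-arcs and the arcs are ranked by a function into
-- ℕ (so no cycle exists).  From an edge clique cover C_1, …, C_t we send every
-- vertex to a new sink c_i for each clique C_i containing it; this gives the
-- classical bound k(G) ≤ θ_E(G).  If some clique C_1 misses a vertex w of G,
-- the clique C_1 may use w itself as its sink, giving k(G) ≤ t - 1.
-- The only lower bound needed: an acyclic digraph has a vertex without
-- out-arcs, so a nonempty graph without isolated vertices has k(G) ≥ 1.
--
-- Edgeless: k = θ_E = 0.  Complete with an
-- edge: k = θ_E = 1.  Otherwise G has an edge (so θ_E ≥ 1) and a non-edge xy,
-- which no clique can contain; hence the first clique of a minimum cover
-- misses x or y, and k(G) ≤ θ_E(G) - 1.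

open import Defs
open import Data.Nat using (ℕ)
open import Data.Sum using (_⊎_)
open import Relation.Binary.PropositionalEquality using (_≡_)
open import Function.Bundles using (_⇔_)

open import Data.Nat using (zero; suc; _+_; _<_; _≤_; z≤n; s≤s)
open import Data.Nat.Properties using (<-trans; <-irrefl; ≤-antisym; n≤0⇒n≡0; m≤n⇒m<n∨m≡n; n<1+n)
open import Data.Fin using (Fin; splitAt; join; _↑ˡ_; toℕ; _≟_)
open import Data.Fin.Properties using (splitAt-↑ˡ; splitAt⁻¹-↑ˡ; splitAt-join; join-splitAt; pigeonhole; any?)
open import Data.Fin.Subset using (Subset; _∈_; _∉_; ⊤)
open import Data.Fin.Subset.Properties using (_∈?_; ∈⊤)
open import Data.Vec using (lookup)
open import Data.Vec.Properties using ([]=⇒lookup; lookup⇒[]=)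
open import Data.Bool using (Bool; true; false; if_then_else_)
open import Data.Bool.Properties using (¬-not) renaming (_≟_ to _≟ᵇ_)
open import Data.Sum using (inj₁; inj₂)
open import Data.Product using (Σ; ∃; ∃₂; _×_; _,_; proj₁; proj₂)
open import Data.Empty using (⊥-elim)
open import Relation.Nullary using (¬_; yes; no; ¬?; _×-dec_)
open import Relation.Binary.PropositionalEquality using (refl; trans; cong; subst; _≢_)
  renaming (sym to ≡-sym)
open import Relation.Binary.Construct.Closure.Transitive using (TransClosure; [_]; _∷_; _∷ʳ_)
open import Function.Bundles using (mk⇔; Equivalence)

open Equivalence using (to; from)

IsMinimum : (ℕ → Set) → ℕ → Set
IsMinimum P m = P m × (∀ m' → P m' → m ≤ m')

minimum≡0 : ∀ {P m} → IsMinimum P m → P 0 → m ≡ 0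
minimum≡0 (_ , least) p0 = n≤0⇒n≡0 (least 0 p0)

minimum≡1 : ∀ {P m} → IsMinimum P m → P 1 → ¬ P 0 → m ≡ 1
minimum≡1 {m = zero}  (pm , _)     _  ¬p0 = ⊥-elim (¬p0 pm)
minimum≡1 {m = suc _} (_ , least) p1 _   = ≤-antisym (least 1 p1) (s≤s z≤n)

ranked⇒acyclic : ∀ {m} (D : Digraph m) (rank : Fin m → ℕ) →
  (∀ x y → Arc D x y → rank x < rank y) → Acyclic D
ranked⇒acyclic D rank increasing v cycle = <-irrefl refl (rise cycle)
  where
  rise : ∀ {x y} → TransClosure (Arc D) x y → rank x < rank y
  rise [ e ]        = increasing _ _ e
  rise (e ∷ walk)   = <-trans (increasing _ _ e) (rise walk)

sequence-walk : ∀ {A : Set} (R : A → A → Set) (f : ℕ → A) →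
  (∀ i → R (f i) (f (suc i))) → ∀ {i j} → i < j → TransClosure R (f i) (f j)
sequence-walk R f step {i} {suc j} (s≤s i≤j) with m≤n⇒m<n∨m≡n i≤j
... | inj₁ i<j  = sequence-walk R f step i<j ∷ʳ step j
... | inj₂ refl = [ step i ]

-- In an acyclic digraph on a nonempty vertex set some vertex has no out-arc:
-- otherwise following out-arcs m + 1 times repeats a vertex (pigeonhole).
acyclic⇒sink : ∀ {m} (D : Digraph m) → Acyclic D → Fin m →
  ¬ (∀ x → ∃ λ y → Arc D x y)
acyclic⇒sink {m} D acyclic start successor = acyclic (visit (toℕ i)) cycle
  where
  visit : ℕ → Fin m
  visit zero    = start
  visit (suc j) = proj₁ (successor (visit j))

  repeat = pigeonhole (n<1+n m) (λ (j : Fin (suc m)) → visit (toℕ j))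
  i = proj₁ repeat
  j = proj₁ (proj₂ repeat)

  cycle : TransClosure (Arc D) (visit (toℕ i)) (visit (toℕ i))
  cycle = subst (TransClosure (Arc D) (visit (toℕ i))) (≡-sym (proj₂ (proj₂ (proj₂ repeat))))
    (sequence-walk (Arc D) visit (λ j → proj₂ (successor (visit j))) (proj₁ (proj₂ (proj₂ repeat))))

Vertex : ℕ → ℕ → Set
Vertex n k = Fin n ⊎ Fin k

adjUnion : ∀ {n} k → Graph n → Vertex n k → Vertex n k → Bool
adjUnion k G (inj₁ a) (inj₁ b) = adj G a b
adjUnion k G (inj₁ _) (inj₂ _) = false
adjUnion k G (inj₂ _) _        = false

adj-addIsolated : ∀ {n} k (G : Graph n) x y →
  adj (addIsolated G k) x y ≡ adjUnion k G (splitAt n x) (splitAt n y)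
adj-addIsolated {n} k G x y with splitAt n x | splitAt n y
... | inj₁ _ | inj₁ _ = refl
... | inj₁ _ | inj₂ _ = refl
... | inj₂ _ | inj₁ _ = refl
... | inj₂ _ | inj₂ _ = refl

adj-↑ˡ : ∀ {n} k (G : Graph n) a b → adj (addIsolated G k) (a ↑ˡ k) (b ↑ˡ k) ≡ adj G a b
adj-↑ˡ {n} k G a b rewrite adj-addIsolated k G (a ↑ˡ k) (b ↑ˡ k)
                         | splitAt-↑ˡ n a k | splitAt-↑ˡ n b k = refl

-- Digraphs on G ∪ I_k in which only old vertices have out-arcs, given by the
-- out-arcs of the old vertices.
OutArcs : ℕ → ℕ → Set
OutArcs n k = Fin n → Vertex n k → Bool

arcFrom : ∀ {n k} → OutArcs n k → Vertex n k → Vertex n k → Bool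
arcFrom out (inj₁ a) v = out a v
arcFrom out (inj₂ _) v = false

CommonOut : ∀ {n k} → (Vertex n k → Vertex n k → Bool) → Vertex n k → Vertex n k → Set
CommonOut {n} {k} arcs s u = Σ (Vertex n k) λ v → arcs s v ≡ true × arcs u v ≡ true

digraphOf : ∀ {n k} → OutArcs n k → Digraph (n + k)
digraphOf {n} out = record { arc = λ x y → arcFrom out (splitAt n x) (splitAt n y) }

competition-via-splitAt : ∀ {n k} (G : Graph n) (out : OutArcs n k) →
  (∀ s u → (adjUnion k G s u ≡ true) ⇔ (s ≢ u × CommonOut (arcFrom out) s u)) →
  IsCompetitionGraph (digraphOf out) (addIsolated G k)
competition-via-splitAt {n} {k} G out spec x y = mk⇔ forward backward
  where
  arcs = arcFrom out
  sx = splitAt n x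
  sy = splitAt n y
  split-injective : sx ≡ sy → x ≡ y
  split-injective eq = trans (≡-sym (join-splitAt n k x)) (trans (cong (join n k) eq) (join-splitAt n k y))

  forward : adj (addIsolated G k) x y ≡ true →
    x ≢ y × Σ (Fin (n + k)) λ v → Arc (digraphOf out) x v × Arc (digraphOf out) y v
  forward xy with to (spec sx sy) (trans (≡-sym (adj-addIsolated k G x y)) xy)
  ... | sx≢sy , v , xv , yv =
    (λ x≡y → sx≢sy (cong (splitAt n) x≡y)) , join n k v ,
    subst (λ w → arcs sx w ≡ true) (≡-sym (splitAt-join n k v)) xv ,
    subst (λ w → arcs sy w ≡ true) (≡-sym (splitAt-join n k v)) yv

  backward : x ≢ y × Σ (Fin (n + k)) (λ v → Arc (digraphOf out) x v × Arc (digraphOf out) y v) →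
    adj (addIsolated G k) x y ≡ true
  backward (x≢y , v , xv , yv) = trans (adj-addIsolated k G x y)
    (from (spec sx sy) ((λ eq → x≢y (split-injective eq)) , splitAt n v , xv , yv))

achievable-from-ranked-arcs : ∀ {n} (G : Graph n) k (out : OutArcs n k)
  (rank : Vertex n k → ℕ) → (∀ a v → out a v ≡ true → rank (inj₁ a) < rank v) →
  (∀ a b → (adj G a b ≡ true) ⇔ (a ≢ b × CommonOut (arcFrom out) (inj₁ a) (inj₁ b))) →
  CompetitionAchievable G k
achievable-from-ranked-arcs {n} G k out rank increasing spec =
  digraphOf out ,
  ranked⇒acyclic (digraphOf out) (λ x → rank (splitAt n x)) (λ x y → arcs-increase (splitAt n x) (splitAt n y)) ,
  competition-via-splitAt G out spec′
  where
  arcs-increase : ∀ s v → arcFrom out s v ≡ true → rank s < rank v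
  arcs-increase (inj₁ a) v = increasing a v

  inj₁-injective : ∀ {a b : Fin n} → inj₁ {B = Fin k} a ≡ inj₁ b → a ≡ b
  inj₁-injective refl = refl

  spec′ : ∀ s u → (adjUnion k G s u ≡ true) ⇔ (s ≢ u × CommonOut (arcFrom out) s u)
  spec′ (inj₁ a) (inj₁ b) = mk⇔
    (λ ab → let (a≢b , common) = to (spec a b) ab in (λ eq → a≢b (inj₁-injective eq)) , common)
    (λ (s≢u , common) → from (spec a b) ((λ eq → s≢u (cong inj₁ eq)) , common))
  spec′ (inj₁ _) (inj₂ _) = mk⇔ (λ ()) (λ { (_ , _ , _ , ()) })
  spec′ (inj₂ _) _        = mk⇔ (λ ()) (λ { (_ , _ , () , _) })

SharesClique : ∀ {n t} → (Fin t → Subset n) → Fin n → Fin n → Set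
SharesClique {t = t} C a b = Σ (Fin t) λ i → a ∈ C i × b ∈ C i

achievable-from-clique-sinks : ∀ {n t} (G : Graph n) k (C : Fin t → Subset n) →
  IsEdgeCliqueCover G C → (out : OutArcs n k) (rank : Vertex n k → ℕ) →
  (∀ a v → out a v ≡ true → rank (inj₁ a) < rank v) →
  (∀ a b → CommonOut (arcFrom out) (inj₁ a) (inj₁ b) ⇔ SharesClique C a b) →
  CompetitionAchievable G k
achievable-from-clique-sinks G k C (cliques , covers) out rank increasing sinks =
  achievable-from-ranked-arcs G k out rank increasing λ a b → mk⇔
    (λ ab → edge-distinct ab , from (sinks a b) (covers a b ab))
    (λ (a≢b , common) → let (i , a∈ , b∈) = to (sinks a b) common in cliques i a b a∈ b∈ a≢b)
  where
  edge-distinct : ∀ {a b} → adj G a b ≡ true → a ≢ b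
  edge-distinct {a} ab refl with trans (≡-sym ab) (irrefl G a)
  ... | ()

∉⇒lookup≡false : ∀ {n} {a : Fin n} {S : Subset n} → a ∉ S → lookup S a ≡ false
∉⇒lookup≡false {a = a} {S} a∉S = ¬-not (λ eq → a∉S (lookup⇒[]= a S eq))

-- k(G) ≤ θ_E(G): every vertex points to a new sink for each clique containing it.
cover⇒achievable : ∀ {n t} (G : Graph n) → HasEdgeCliqueCoverOfSize G t → CompetitionAchievable G t
cover⇒achievable {n} {t} G (C , cover) = achievable-from-clique-sinks G t C cover out rank increasing sinks
  where
  out : OutArcs n t
  out a (inj₁ _) = false
  out a (inj₂ i) = lookup (C i) a

  rank : Vertex n t → ℕ
  rank (inj₁ _) = 0
  rank (inj₂ _) = 1

  increasing : ∀ a v → out a v ≡ true → rank (inj₁ a) < rank v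
  increasing a (inj₂ _) _ = s≤s z≤n

  sinks : ∀ a b → CommonOut (arcFrom out) (inj₁ a) (inj₁ b) ⇔ SharesClique C a b
  sinks a b = mk⇔
    (λ { (inj₂ i , a∈ , b∈) → i , lookup⇒[]= a (C i) a∈ , lookup⇒[]= b (C i) b∈ })
    (λ (i , a∈ , b∈) → inj₂ i , []=⇒lookup a∈ , []=⇒lookup b∈)

-- If the first clique of a cover of size t + 1 misses a vertex w, that clique
-- can use w as its sink, and only t new vertices are needed.
missing-vertex⇒achievable : ∀ {n t} (G : Graph n) (C : Fin (suc t) → Subset n) →
  IsEdgeCliqueCover G C → (w : Fin n) → w ∉ C Fin.zero → CompetitionAchievable G t
missing-vertex⇒achievable {n} {t} G C cover w w∉C₀ =
  achievable-from-clique-sinks G t C cover out rank increasing sinks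
  where
  out : OutArcs n t
  out a (inj₁ b) with b ≟ w
  ... | yes _ = lookup (C Fin.zero) a
  ... | no _  = false
  out a (inj₂ i) = lookup (C (Fin.suc i)) a

  into-w : ∀ {a b} → out a (inj₁ b) ≡ true → b ≡ w × lookup (C Fin.zero) a ≡ true
  into-w {a} {b} ab with b ≟ w
  ... | yes b≡w = b≡w , ab

  to-w : ∀ {a} → lookup (C Fin.zero) a ≡ true → out a (inj₁ w) ≡ true
  to-w a∈ with w ≟ w
  ... | yes _  = a∈
  ... | no w≢w = ⊥-elim (w≢w refl)

  -- members of the first clique sit below w, all sinks above every old vertex
  rank : Vertex n t → ℕ
  rank (inj₁ a) = if lookup (C Fin.zero) a then 0 else 1
  rank (inj₂ _) = 2

  rank-old≤1 : ∀ a → rank (inj₁ a) ≤ 1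
  rank-old≤1 a with lookup (C Fin.zero) a
  ... | true  = z≤n
  ... | false = s≤s z≤n

  increasing : ∀ a v → out a v ≡ true → rank (inj₁ a) < rank v
  increasing a (inj₂ _) _ = s≤s (rank-old≤1 a)
  increasing a (inj₁ b) ab with into-w {a} {b} ab
  ... | refl , a∈C₀ rewrite a∈C₀ | ∉⇒lookup≡false w∉C₀ = s≤s z≤n

  sinks : ∀ a b → CommonOut (arcFrom out) (inj₁ a) (inj₁ b) ⇔ SharesClique C a b
  sinks a b = mk⇔ shared common
    where
    shared : CommonOut (arcFrom out) (inj₁ a) (inj₁ b) → SharesClique C a b
    shared (inj₁ v , av , bv) = Fin.zero ,
      lookup⇒[]= a (C Fin.zero) (proj₂ (into-w {a} {v} av)) , lookup⇒[]= b (C Fin.zero) (proj₂ (into-w {b} {v} bv))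
    shared (inj₂ i , a∈ , b∈) = Fin.suc i , lookup⇒[]= a _ a∈ , lookup⇒[]= b _ b∈

    common : SharesClique C a b → CommonOut (arcFrom out) (inj₁ a) (inj₁ b)
    common (Fin.zero , a∈ , b∈)  = inj₁ w , to-w ([]=⇒lookup a∈) , to-w ([]=⇒lookup b∈)
    common (Fin.suc i , a∈ , b∈) = inj₂ i , []=⇒lookup a∈ , []=⇒lookup b∈

-- A nonempty graph without isolated vertices has k(G) ≥ 1: in C(D) every
-- vertex with a neighbour has an out-arc, while acyclic D has a sink.
no-isolated⇒¬achievable₀ : ∀ {n} (G : Graph n) → Fin n →
  (∀ a → ∃ λ b → adj G a b ≡ true) → ¬ CompetitionAchievable G 0
no-isolated⇒¬achievable₀ {n} G a₀ neighbour (D , acyclic , competition) =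
  acyclic⇒sink D acyclic (a₀ ↑ˡ 0) out-arc
  where
  old : (x : Fin (n + 0)) → ∃ λ a → a ↑ˡ 0 ≡ x
  old x with splitAt n x in eq
  ... | inj₁ a = a , splitAt⁻¹-↑ˡ eq

  out-arc : ∀ x → ∃ λ v → Arc D x v
  out-arc x with old x
  ... | a , refl =
    let (b , ab) = neighbour a
        (_ , v , av , _) = to (competition (a ↑ˡ 0) (b ↑ˡ 0)) (trans (adj-↑ˡ 0 G a b) ab)
    in v , av

edge-or-edgeless : ∀ {n} (G : Graph n) → (∃₂ λ a b → adj G a b ≡ true) ⊎ IsEdgeless G
edge-or-edgeless G with any? (λ a → any? (λ b → adj G a b ≟ᵇ true))
... | yes (a , b , ab) = inj₁ (a , b , ab)
... | no no-edge       = inj₂ (λ a b → ¬-not (λ ab → no-edge (a , b , ab)))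

non-edge-or-complete : ∀ {n} (G : Graph n) →
  (∃₂ λ x y → x ≢ y × adj G x y ≡ false) ⊎ IsComplete G
non-edge-or-complete G with any? (λ x → any? (λ y → ¬? (x ≟ y) ×-dec (adj G x y ≟ᵇ false)))
... | yes (x , y , xy) = inj₁ (x , y , xy)
... | no no-non-edge   = inj₂ (λ x y x≢y → ¬-not (λ xy → no-non-edge (x , y , x≢y , xy)))

edgeless⇒cover₀ : ∀ {n} (G : Graph n) → IsEdgeless G → HasEdgeCliqueCoverOfSize G 0
edgeless⇒cover₀ {n} G edgeless = no-cliques , (λ ()) , no-edge
  where
  no-cliques : Fin 0 → Subset n
  no-cliques ()

  no-edge : ∀ a b → adj G a b ≡ true → SharesClique no-cliques a b
  no-edge a b ab with trans (≡-sym ab) (edgeless a b)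
  ... | ()

edge⇒¬cover₀ : ∀ {n} (G : Graph n) {a b} → adj G a b ≡ true → ¬ HasEdgeCliqueCoverOfSize G 0
edge⇒¬cover₀ G ab (_ , _ , covers) with covers _ _ ab
... | () , _

complete⇒cover₁ : ∀ {n} (G : Graph n) → IsComplete G → HasEdgeCliqueCoverOfSize G 1
complete⇒cover₁ G complete = (λ _ → ⊤) , (λ _ x y _ _ x≢y → complete x y x≢y) , λ _ _ _ → Fin.zero , ∈⊤ , ∈⊤

complete-with-edge⇒no-isolated : ∀ {n} (G : Graph n) → IsComplete G → ∀ {a b} →
  adj G a b ≡ true → ∀ x → ∃ λ y → adj G x y ≡ true
complete-with-edge⇒no-isolated G complete {a} {b} ab x with x ≟ a
... | yes refl = b , ab
... | no x≢a   = a , complete x a x≢a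

-- Neither complete nor edgeless: a clique cannot contain the non-edge xy, so the
-- first clique of any cover misses x or y, and k(G) < θ_E(G).
mixed⇒k<θ : ∀ {n} (G : Graph n) {a b x y k t} → adj G a b ≡ true →
  x ≢ y → adj G x y ≡ false → IsMinimum (CompetitionAchievable G) k →
  HasEdgeCliqueCoverOfSize G t → k < t
mixed⇒k<θ G {t = zero} ab _ _ _ cover = ⊥-elim (edge⇒¬cover₀ G ab cover)
mixed⇒k<θ G {x = x} {y} {t = suc t} _ x≢y xy (_ , least) (C , cliques , _)
  with x ∈? C Fin.zero | y ∈? C Fin.zero
... | yes x∈ | yes y∈ with trans (≡-sym (cliques Fin.zero x y x∈ y∈ x≢y)) xy
...   | ()
mixed⇒k<θ G {x = x} {t = suc t} _ _ _ (_ , least) (C , cover) | no x∉ | _ =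
  s≤s (least t (missing-vertex⇒achievable G C cover x x∉))
mixed⇒k<θ G {y = y} {t = suc t} _ _ _ (_ , least) (C , cover) | yes _ | no y∉ =
  s≤s (least t (missing-vertex⇒achievable G C cover y y∉))

mainTheorem2 : (n : ℕ) (G : Graph n) (k t : ℕ) →
    IsCompetitionNumber G k → IsEdgeCliqueCoverNumber G t →
    (k ≡ t) ⇔ (IsComplete G ⊎ IsEdgeless G)
mainTheorem2 n G k t compK coverT = mk⇔ only-if if
  where
  if : IsComplete G ⊎ IsEdgeless G → k ≡ t
  if (inj₂ edgeless) = trans (minimum≡0 compK (cover⇒achievable G cover₀)) (≡-sym (minimum≡0 coverT cover₀))
    where cover₀ = edgeless⇒cover₀ G edgeless
  if (inj₁ complete) with edge-or-edgeless G
  ... | inj₂ edgeless = if (inj₂ edgeless)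
  ... | inj₁ (a , b , ab) =
    trans (minimum≡1 compK (cover⇒achievable G cover₁)
                     (no-isolated⇒¬achievable₀ G a (complete-with-edge⇒no-isolated G complete ab)))
          (≡-sym (minimum≡1 coverT cover₁ (edge⇒¬cover₀ G ab)))
    where cover₁ = complete⇒cover₁ G complete

  only-if : k ≡ t → IsComplete G ⊎ IsEdgeless G
  only-if k≡t with non-edge-or-complete G | edge-or-edgeless G
  ... | inj₂ complete | _ = inj₁ complete
  ... | inj₁ _ | inj₂ edgeless = inj₂ edgeless
  ... | inj₁ (x , y , x≢y , xy) | inj₁ (a , b , ab) =
    ⊥-elim (<-irrefl k≡t (mixed⇒k<θ G ab x≢y xy compK (proj₁ coverT)))
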